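{- Let $\mathcal{M}$ be a unitary magma. Then $\mathrm{C}\mathcal{M}$, endowed with the partial compositions $\circ_i$ described in the context and with the clique $\mathbf{u}$ as unit, is a (nonsymmetric) operad. Moreover, the construction $\mathrm{C}$ (on objects $\mathcal{M}\mapsto\mathrm{C}\mathcal{M}$, on morphisms $\phi\mapsto\mathrm{C}\phi$) is a functor from the category of unitary magmas to the category of operads; if $\phi$ is injective (resp. surjective) then $\mathrm{C}\phi$ is injective (resp. surjective); and every operad $\mathrm{C}\mathcal{M}$ is a set-operad, i.e., it is the linearization of an operad in the category of sets whose elements in arity $n$ are the $\mathcal{M}$-cliques of size $n$ (the partial composition of two $\mathcal{M}$-cliques is an $\mathcal{M}$-clique).
   Context: A unitary magma is a set $\mathcal{M}$ with a binary operation $\star$ (not necessarily associative) admitting a two-sided unit $\mathds{1}_\mathcal{M}$; morphisms of unitary magmas are maps preserving $\star$ and the unit. For $n\geq 1$, an $\mathcal{M}$-clique of size $n$ is a complete graph $\mathfrak{p}$ on the vertex set $[n+1]=\{1,\dots,n+1\}$ together with a labeling assigning to each arc $(x,y)$, $1\leq x<y\leq n+1$, an element $\mathfrak{p}(x,y)\in\mathcal{M}$. The arc $(1,n+1)$ is the base, and for $1\le i\le n$ the arc $(i,i+1)$ is the $i$-th edge. Let $\mathbb{K}$ be a field of characteristic zero. Define the graded vector space $\mathrm{C}\mathcal{M}=\bigoplus_{n\geq1}\mathrm{C}\mathcal{M}(n)$, where $\mathrm{C}\mathcal{M}(1)$ is spanned by the single $\mathcal{M}$-clique $\mathbf{u}$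 of size $1$ whose base is labeled $\mathds{1}_\mathcal{M}$, and, for $n\geq2$, $\mathrm{C}\mathcal{M}(n)$ has as basis the set of all $\mathcal{M}$-cliques of size $n$. For $\mathfrak{p}$ of size $n$, $\mathfrak{q}$ of size $m$ and $i\in[n]$, the $\mathcal{M}$-clique $\mathfrak{p}\circ_i\mathfrak{q}$ of size $n+m-1$ is obtained by gluing the base of $\mathfrak{q}$ onto the $i$-th edge of $\mathfrak{p}$ and renumbering vertices: vertex $x$ of $\mathfrak{p}$ becomes $x$ if $x\le i$ and $x+m-1$ if $x\ge i+1$, vertex $y$ of $\mathfrak{q}$ becomes $y+i-1$; every arc of $\mathfrak{p}$ other than its $i$-th edge and every arc of $\mathfrak{q}$ other than its base keeps its label, the common arc $(i,i+m)$ receives the label $\mathfrak{p}(i,i+1)\star\mathfrak{q}(1,m+1)$, and all remaining arcs receive the label $\mathds{1}_\mathcal{M}$. The maps $\circ_i$ are extended bilinearly. For a morphism $\phi:\mathcal{M}_1\to\mathcal{M}_2$ of unitary magmas, $\mathrm{C}\phi:\mathrm{C}\mathcal{M}_1\to\mathrm{C}\mathcal{M}_2$ is the linear map sending an $\mathcal{M}_1$-clique $\mathfrak{p}$ of size $n$ to the $\mathcal{M}_2$-clique of size $n$ whose arc $(x,y)$ is labeled $\phi(\mathfrak{p}(x,y))$. -}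

module Defs where

open import Level using (Level; _⊔_)
open import Data.Bool.Base using (Bool; true; false; if_then_else_; _∧_; _∨_)
open import Data.Nat.Base using (ℕ; zero; suc; _+_; _∸_; _≤_; _<_; _≡ᵇ_; _≤ᵇ_; s≤s)
open import Data.Nat.Properties using (+-identityʳ; +-assoc; +-comm; +-mono-≤; +-monoˡ-≤)
open import Data.Fin.Base using (Fin; toℕ; fromℕ<; _↑ˡ_) renaming (_<_ to _<ᶠ_; zero to fzero)
open import Data.Fin.Properties using (toℕ≤pred[n])
open import Relation.Binary.PropositionalEquality using (_≡_; refl; subst; cong; sym) renaming (trans to ≡-trans)
open import Relation.Binary.Structures using (IsEquivalence)
open import Algebra.Bundles using (UnitalMagma; RawMonoid)
open import Algebra.Morphism.Structures using (IsMonoidHomomorphism)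

-- For i ∈ Fin (1+a) (position i'+1 in [n], n = 1+a) and
-- j ∈ Fin (1+b), `i ⊕ j` is the 0-based position i'+j', i.e. the
-- 1-based position i + j - 1 of [n + m - 1].
_⊕_ : ∀ {a b} → Fin (suc a) → Fin (suc b) → Fin (suc (a + b))
_⊕_ {a} {b} i j = fromℕ< (s≤s (+-mono-≤ (toℕ≤pred[n] i) (toℕ≤pred[n] j)))

-- `shiftBy b j` is the 0-based position j' + b, i.e. the 1-based
-- position j + m - 1 where m = 1 + b.
shiftBy : ∀ {a} b → Fin (suc a) → Fin (suc (a + b))
shiftBy {a} b j = fromℕ< (s≤s (+-monoˡ-≤ b (toℕ≤pred[n] j)))

+-rcomm : ∀ a b c → a + b + c ≡ a + c + b
+-rcomm a b c = ≡-trans (+-assoc a b c) (≡-trans (cong (a +_) (+-comm b c)) (sym (+-assoc a c b)))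

-- Arity n ≥ 1 is written suc a.

record IsNSOperad {o e : Level} (O : ℕ → Set o)
    (_≈_ : ∀ {n} → O n → O n → Set e)
    (_∘⟨_⟩_ : ∀ {a b} → O (suc a) → Fin (suc a) → O (suc b) → O (suc (a + b)))
    (𝟙 : O 1) : Set (o ⊔ e) where
  field
    isEquivalence : ∀ {n} → IsEquivalence (_≈_ {suc n})
    ∘-cong : ∀ {a b} {x x′ : O (suc a)} {y y′ : O (suc b)} (i : Fin (suc a)) →
             x ≈ x′ → y ≈ y′ → (x ∘⟨ i ⟩ y) ≈ (x′ ∘⟨ i ⟩ y′)
    unitˡ : ∀ {b} (y : O (suc b)) → (𝟙 ∘⟨ fzero ⟩ y) ≈ y
    unitʳ : ∀ {a} (x : O (suc a)) (i : Fin (suc a)) →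
            subst O (cong suc (+-identityʳ a)) (x ∘⟨ i ⟩ 𝟙) ≈ x
    assoc : ∀ {a b c} (x : O (suc a)) (y : O (suc b)) (z : O (suc c))
            (i : Fin (suc a)) (j : Fin (suc b)) →
            subst O (cong suc (+-assoc a b c)) ((x ∘⟨ i ⟩ y) ∘⟨ i ⊕ j ⟩ z)
              ≈ (x ∘⟨ i ⟩ (y ∘⟨ j ⟩ z))
    comm : ∀ {a b c} (x : O (suc a)) (y : O (suc b)) (z : O (suc c))
           (i j : Fin (suc a)) → i <ᶠ j →
           subst O (cong suc (+-rcomm a b c))
             ((x ∘⟨ i ⟩ y) ∘⟨ shiftBy b j ⟩ z)
             ≈ ((x ∘⟨ j ⟩ z) ∘⟨ i ↑ˡ c ⟩ y)

module Cliques {c ℓ : Level} (M : UnitalMagma c ℓ) where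
  open UnitalMagma M renaming (refl to ≈-refl; trans to ≈-trans)

  -- An M-clique of size n: vertices are 0,1,…,n (0-based version of
  -- [n+1]); the label of the arc between 0-based vertices x < y ≤ n is
  -- `lab x y` (values of `lab` outside arcs are irrelevant, see _≈C_).
  -- The base is the arc (0,n), the i-th edge is (i-1,i).
  -- In size 1 the only clique is 𝐮 (base labeled by the unit).
  record Clique (n : ℕ) : Set (c ⊔ ℓ) where
    constructor mkClique
    field
      lab       : ℕ → ℕ → Carrier
      base-unit : n ≡ 1 → lab 0 1 ≈ ε
  open Clique public

  _≈C_ : ∀ {n} → Clique n → Clique n → Set ℓ
  _≈C_ {n} p q = ∀ x y → x < y → y ≤ n → lab p x y ≈ lab q x y

  𝐮 : Clique 1
  𝐮 = mkClique (λ _ _ → ε) (λ _ → ≈-refl)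

  -- Labels of p ∘ᵢ q (0-based: i = position of the i-th edge's left
  -- vertex, m = size of q).  Vertices of p: x ↦ x (x ≤ i), x ↦ x + m - 1
  -- (x > i); vertices of q: y ↦ y + i.  Arc (i, i+m) gets p(i,i+1) ⋆ q(0,m),
  -- other arcs coming from q or from p keep their labels, all others get 𝟙.
  compLab : ℕ → (ℕ → ℕ → Carrier) → ℕ → (ℕ → ℕ → Carrier) → ℕ → ℕ → Carrier
  compLab i p m q x y =
    if (x ≡ᵇ i) ∧ (y ≡ᵇ i + m) then p i (suc i) ∙ q 0 m
    else if (i ≤ᵇ x) ∧ (y ≤ᵇ i + m) then q (x ∸ i) (y ∸ i)
    else if inP x ∧ inP y then p (un x) (un y)
    else ε
    where
      inP : ℕ → Bool
      inP z = (z ≤ᵇ i) ∨ (i + m ≤ᵇ z)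
      un : ℕ → ℕ
      un z = if z ≤ᵇ i then z else z ∸ (m ∸ 1)

  private
    comp-unit : ∀ {a b} (p : Clique (suc a)) (i : Fin (suc a)) (q : Clique (suc b)) →
                suc (a + b) ≡ 1 →
                compLab (toℕ i) (lab p) (suc b) (lab q) 0 1 ≈ ε
    comp-unit {zero} {zero} p fzero q refl =
      ≈-trans (∙-cong (base-unit p refl) (base-unit q refl)) (identityˡ ε)

  _∘⟨_⟩_ : ∀ {a b} → Clique (suc a) → Fin (suc a) → Clique (suc b) → Clique (suc (a + b))
  _∘⟨_⟩_ {a} {b} p i q =
    mkClique (compLab (toℕ i) (lab p) (suc b) (lab q)) (comp-unit p i q)

rawUM : ∀ {c ℓ} → UnitalMagma c ℓ → RawMonoid c ℓ
rawUM M = record { Carrier = Carrier ; _≈_ = _≈_ ; _∙_ = _∙_ ; ε = ε }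
  where open UnitalMagma M

module _ {c₁ ℓ₁ c₂ ℓ₂ : Level} {M₁ : UnitalMagma c₁ ℓ₁} {M₂ : UnitalMagma c₂ ℓ₂} where
  private
    module M₁ = UnitalMagma M₁
    module M₂ = UnitalMagma M₂
    module C₁ = Cliques M₁
    module C₂ = Cliques M₂

  IsUnitalMagmaMorphism : (M₁.Carrier → M₂.Carrier) → Set (c₁ ⊔ ℓ₁ ⊔ ℓ₂)
  IsUnitalMagmaMorphism = IsMonoidHomomorphism (rawUM M₁) (rawUM M₂)

  C[_,_] : (φ : M₁.Carrier → M₂.Carrier) → IsUnitalMagmaMorphism φ →
           ∀ {n} → C₁.Clique n → C₂.Clique n
  C[ φ , h ] p = C₂.mkClique (λ x y → φ (C₁.lab p x y))
    (λ eq → M₂.trans (IsMonoidHomomorphism.⟦⟧-cong h (C₁.base-unit p eq))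
                     (IsMonoidHomomorphism.ε-homo h))

record IsNSOperadMorphism {o₁ e₁ o₂ e₂ : Level}
    {O₁ : ℕ → Set o₁} (_≈₁_ : ∀ {n} → O₁ n → O₁ n → Set e₁)
    (_∘₁⟨_⟩_ : ∀ {a b} → O₁ (suc a) → Fin (suc a) → O₁ (suc b) → O₁ (suc (a + b)))
    (𝟙₁ : O₁ 1)
    {O₂ : ℕ → Set o₂} (_≈₂_ : ∀ {n} → O₂ n → O₂ n → Set e₂)
    (_∘₂⟨_⟩_ : ∀ {a b} → O₂ (suc a) → Fin (suc a) → O₂ (suc b) → O₂ (suc (a + b)))
    (𝟙₂ : O₂ 1)
    (f : ∀ {n} → O₁ n → O₂ n) : Set (o₁ ⊔ e₁ ⊔ e₂) where
  field
    f-cong   : ∀ {a} {x y : O₁ (suc a)} → x ≈₁ y → f x ≈₂ f y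
    ∘-homo   : ∀ {a b} (x : O₁ (suc a)) (i : Fin (suc a)) (y : O₁ (suc b)) →
               f (x ∘₁⟨ i ⟩ y) ≈₂ (f x ∘₂⟨ i ⟩ f y)
    unit-homo : f 𝟙₁ ≈₂ 𝟙₂

CIsOperad : ∀ {c ℓ} → UnitalMagma c ℓ → Set (c ⊔ ℓ)
CIsOperad M = IsNSOperad Clique (λ {n} → _≈C_ {n}) (λ {a} {b} → _∘⟨_⟩_ {a} {b}) 𝐮
  where open Cliques M

CIsOperadMorphism : ∀ {c₁ ℓ₁ c₂ ℓ₂} (M₁ : UnitalMagma c₁ ℓ₁) (M₂ : UnitalMagma c₂ ℓ₂)
  (φ : UnitalMagma.Carrier M₁ → UnitalMagma.Carrier M₂) →
  IsUnitalMagmaMorphism {M₁ = M₁} {M₂ = M₂} φ → Set (c₁ ⊔ ℓ₁ ⊔ ℓ₂)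
CIsOperadMorphism M₁ M₂ φ h =
  IsNSOperadMorphism (λ {n} → C₁._≈C_ {n}) (λ {a} {b} → C₁._∘⟨_⟩_ {a} {b}) C₁.𝐮
                     (λ {n} → C₂._≈C_ {n}) (λ {a} {b} → C₂._∘⟨_⟩_ {a} {b}) C₂.𝐮
                     (λ {n} → C[ φ , h ] {n})
  where
    module C₁ = Cliques M₁
    module C₂ = Cliques M₂

{-# OPTIONS --safe #-}
-- An arc of p ∘ᵢ q either is the glued arc, or comes from p, or comes from q, or joins a vertex
-- strictly inside q to a vertex outside it (label 𝟙).  Each operad axiom is an equality of labels
-- and is checked arc by arc according to this position: both sides reduce to the same label of an
-- input clique, to 𝟙, or, on glued arcs, to products that agree because 𝟙 is a two-sided unit.  A morphism φ preserves ⋆ and 𝟙,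
-- so it commutes with composition arc by arc.
module Submission where

open import Defs
open import Level using (Level)
open import Data.Bool.Base using (true; false; _∧_)
open import Data.Bool.Properties using (∧-zeroʳ)
open import Data.Nat.Base
open import Data.Nat.Properties
open import Data.Fin.Base using (Fin; toℕ; _↑ˡ_) renaming (_<_ to _<ᶠ_)
open import Data.Fin.Properties using (toℕ≤pred[n]; toℕ-fromℕ<; toℕ-↑ˡ)
open import Data.Product using (_×_; _,_; proj₁; proj₂)
open import Data.Sum.Base using (_⊎_; inj₁; inj₂) renaming (map to ⊎-map)
open import Data.Empty using (⊥-elim)
open import Function.Base using (id; _∘_)
open import Function.Definitions using (Injective; Surjective)
open import Relation.Nullary.Decidable using (Dec; yes; no; dec-true; dec-false)
open import Relation.Binary.Definitions using (tri<; tri≈; tri>)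
open import Relation.Binary.PropositionalEquality
  using (_≡_; _≢_; refl; sym; trans; cong; cong₂; subst; subst₂; module ≡-Reasoning)
open import Algebra.Bundles using (UnitalMagma; module UnitalMagma)
open import Algebra.Morphism.Structures using (IsMonoidHomomorphism)
import Algebra.Morphism.Construct.Identity as MId
import Algebra.Morphism.Construct.Composition as MComp
import Relation.Binary.Reasoning.Setoid as SetoidReasoning

≤ᵇ-true : ∀ {m n} → m ≤ n → (m ≤ᵇ n) ≡ true
≤ᵇ-true = dec-true (_ ≤? _)

≤ᵇ-false : ∀ {m n} → n < m → (m ≤ᵇ n) ≡ false
≤ᵇ-false n<m = dec-false (_ ≤? _) (<⇒≱ n<m)

≡ᵇ-refl : ∀ m → (m ≡ᵇ m) ≡ true
≡ᵇ-refl m = dec-true (m ≟ m) refl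

≡ᵇ-false : ∀ {m n} → m ≢ n → (m ≡ᵇ n) ≡ false
≡ᵇ-false = dec-false (_ ≟ _)

≡ᵇ-∧-≡ᵇ-false : ∀ {m n o p} → m ≢ n ⊎ o ≢ p → ((m ≡ᵇ n) ∧ (o ≡ᵇ p)) ≡ false
≡ᵇ-∧-≡ᵇ-false (inj₁ m≢n) rewrite ≡ᵇ-false m≢n = refl
≡ᵇ-∧-≡ᵇ-false {m} {n} (inj₂ o≢p) rewrite ≡ᵇ-false o≢p = ∧-zeroʳ (m ≡ᵇ n)

m+n≤o⇒n≤o∸m : ∀ m {n o} → m + n ≤ o → n ≤ o ∸ m
m+n≤o⇒n≤o∸m m {n} {o} m+n≤o = m+n≤o⇒m≤o∸n n (subst (_≤ o) (+-comm m n) m+n≤o)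

m+n<o⇒n<o∸m : ∀ m {n o} → m + n < o → n < o ∸ m
m+n<o⇒n<o∸m m {n} {o} m+n<o = m+n≤o⇒n≤o∸m m (subst (_≤ o) (sym (+-suc m n)) m+n<o)

m≤n+o⇒m∸o≤n : ∀ m n {o} → m ≤ n + o → m ∸ o ≤ n
m≤n+o⇒m∸o≤n m n {o} m≤n+o = m≤n+o⇒m∸n≤o m o (subst (m ≤_) (+-comm n o) m≤n+o)

n≤m<n+o⇒m∸n<o : ∀ {m n o} → n ≤ m → m < n + o → m ∸ n < o
n≤m<n+o⇒m∸n<o {m} {n} {o} n≤m m<n+o = subst (m ∸ n <_) (m+n∸m≡n n o) (∸-monoˡ-< m<n+o n≤m)

n≤m<o+n⇒m∸n<o : ∀ {m n o} → n ≤ m → m < o + n → m ∸ n < o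
n≤m<o+n⇒m∸n<o {m} {n} {o} n≤m m<o+n = n≤m<n+o⇒m∸n<o n≤m (subst (m <_) (+-comm o n) m<o+n)

m+[1+n]≤o⇒m<o∸n : ∀ m n {o} → m + suc n ≤ o → m < o ∸ n
m+[1+n]≤o⇒m<o∸n m n {o} m+[1+n]≤o = m+n≤o⇒m≤o∸n (suc m) (subst (_≤ o) (+-suc m n) m+[1+n]≤o)

m<n⇒n≮m+1 : ∀ {m n} → m < n → n ≮ m + 1
m<n⇒n≮m+1 {m} {n} m<n n<m+1 = <⇒≱ m<n (≤-pred (subst (n <_) (+-comm m 1) n<m+1))

m∸n∸o≡m∸o∸n : ∀ m n o → m ∸ n ∸ o ≡ m ∸ o ∸ n
m∸n∸o≡m∸o∸n m n o = trans (∸-+-assoc m n o) (trans (cong (m ∸_) (+-comm n o)) (sym (∸-+-assoc m o n)))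

m∸n∸o≡m∸[o+n] : ∀ m n o → m ∸ n ∸ o ≡ m ∸ (o + n)
m∸n∸o≡m∸[o+n] m n o = trans (∸-+-assoc m n o) (cong (m ∸_) (+-comm n o))

m+[1+n]∸n≡1+m : ∀ m n → m + suc n ∸ n ≡ suc m
m+[1+n]∸n≡1+m m n = trans (cong (_∸ n) (+-suc m n)) (m+n∸n≡m (suc m) n)

toℕ-⊕ : ∀ {a b} (i : Fin (suc a)) (j : Fin (suc b)) → toℕ (i ⊕ j) ≡ toℕ i + toℕ j
toℕ-⊕ i j = toℕ-fromℕ< _

toℕ-shiftBy : ∀ {a} b (j : Fin (suc a)) → toℕ (shiftBy b j) ≡ toℕ j + b
toℕ-shiftBy b j = toℕ-fromℕ< _

-- Where an arc (x, y) of p ∘ᵢ q lies relative to the vertices i, …, i + suc b taken by q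
-- (0-based, q of size suc b); the arcs intoQ and outOfQ come from neither p nor q.
data ArcPosition (i b x y : ℕ) : Set where
  glued   : x ≡ i → y ≡ i + suc b → ArcPosition i b x y
  insideQ : i ≤ x → y ≤ i + suc b → i < x ⊎ y < i + suc b → ArcPosition i b x y
  beforeQ : y ≤ i → ArcPosition i b x y
  overQ   : x ≤ i → i + suc b ≤ y → x < i ⊎ i + suc b < y → ArcPosition i b x y
  afterQ  : i + suc b ≤ x → ArcPosition i b x y
  intoQ   : x < i → i < y → y < i + suc b → ArcPosition i b x y
  outOfQ  : i < x → x < i + suc b → i + suc b < y → ArcPosition i b x y

arcPosition : ∀ i b x y → x < y → ArcPosition i b x y
arcPosition i b x y x<y with <-cmp y i | <-cmp x i | <-cmp y (i + suc b) | <-cmp x (i + suc b)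
... | tri< y<i _ _ | _ | _ | _ = beforeQ (<⇒≤ y<i)
... | tri≈ _ y≡i _ | _ | _ | _ = beforeQ (≤-reflexive y≡i)
... | tri> _ _ i<y | tri< x<i _ _ | tri< y<k _ _ | _ = intoQ x<i i<y y<k
... | tri> _ _ i<y | tri< x<i _ _ | tri≈ _ y≡k _ | _ =
  overQ (<⇒≤ x<i) (≤-reflexive (sym y≡k)) (inj₁ x<i)
... | tri> _ _ i<y | tri< x<i _ _ | tri> _ _ k<y | _ = overQ (<⇒≤ x<i) (<⇒≤ k<y) (inj₁ x<i)
... | tri> _ _ i<y | tri≈ _ x≡i _ | tri< y<k _ _ | _ =
  insideQ (≤-reflexive (sym x≡i)) (<⇒≤ y<k) (inj₂ y<k)
... | tri> _ _ i<y | tri≈ _ x≡i _ | tri≈ _ y≡k _ | _ = glued x≡i y≡k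
... | tri> _ _ i<y | tri≈ _ x≡i _ | tri> _ _ k<y | _ = overQ (≤-reflexive x≡i) (<⇒≤ k<y) (inj₂ k<y)
... | tri> _ _ i<y | tri> _ _ i<x | tri< y<k _ _ | _ = insideQ (<⇒≤ i<x) (<⇒≤ y<k) (inj₁ i<x)
... | tri> _ _ i<y | tri> _ _ i<x | tri≈ _ y≡k _ | _ = insideQ (<⇒≤ i<x) (≤-reflexive y≡k) (inj₁ i<x)
... | tri> _ _ i<y | tri> _ _ i<x | tri> _ _ k<y | tri< x<k _ _ = outOfQ i<x x<k k<y
... | tri> _ _ i<y | tri> _ _ i<x | tri> _ _ k<y | tri≈ _ x≡k _ = afterQ (≤-reflexive (sym x≡k))
... | tri> _ _ i<y | tri> _ _ i<x | tri> _ _ k<y | tri> _ _ k<x = afterQ (<⇒≤ k<x)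

module CliqueComposition {c ℓ : Level} (M : UnitalMagma c ℓ) where
  open UnitalMagma M renaming (refl to ≈-refl; trans to ≈-trans; sym to ≈-sym)
  open Cliques M

  Labelling : Set c
  Labelling = ℕ → ℕ → Carrier

  module Evaluation (i b : ℕ) (p q : Labelling) where
    private
      i<k : i < i + suc b
      i<k = m<m+n i z<s

      unglued : ∀ {x y} → x ≢ i ⊎ y ≢ i + suc b → ((x ≡ᵇ i) ∧ (y ≡ᵇ i + suc b)) ≡ false
      unglued = ≡ᵇ-∧-≡ᵇ-false

    compLab-glued : compLab i p (suc b) q i (i + suc b) ≡ p i (suc i) ∙ q 0 (suc b)
    compLab-glued rewrite ≡ᵇ-refl i | ≡ᵇ-refl (i + suc b) = refl

    compLab-insideQ : ∀ {x y} → i ≤ x → y ≤ i + suc b → i < x ⊎ y < i + suc b →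
                      compLab i p (suc b) q x y ≡ q (x ∸ i) (y ∸ i)
    compLab-insideQ i≤x y≤k d
      rewrite unglued (⊎-map >⇒≢ <⇒≢ d) | ≤ᵇ-true i≤x | ≤ᵇ-true y≤k = refl

    compLab-beforeQ : ∀ {x y} → x < y → y ≤ i → compLab i p (suc b) q x y ≡ p x y
    compLab-beforeQ {x} {y} x<y y≤i = evaluate (<-≤-trans x<y y≤i)
      where
      evaluate : x < i → compLab i p (suc b) q x y ≡ p x y
      evaluate x<i rewrite unglued {y = y} (inj₁ (<⇒≢ x<i)) | ≤ᵇ-false x<i
                         | ≤ᵇ-true (<⇒≤ x<i) | ≤ᵇ-true y≤i = refl

    compLab-overQ : ∀ {x y} → x ≤ i → i + suc b ≤ y → x < i ⊎ i + suc b < y →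
                    compLab i p (suc b) q x y ≡ p x (y ∸ b)
    compLab-overQ {x} {y} x≤i k≤y d
      rewrite unglued (⊎-map <⇒≢ >⇒≢ d) | ≤ᵇ-true x≤i
            | ≤ᵇ-false (<-≤-trans i<k k≤y) | ≤ᵇ-true k≤y with d
    ... | inj₁ x<i rewrite ≤ᵇ-false x<i = refl
    ... | inj₂ k<y rewrite ≤ᵇ-false k<y | ∧-zeroʳ (i ≤ᵇ x) = refl

    compLab-afterQ : ∀ {x y} → x < y → i + suc b ≤ x →
                     compLab i p (suc b) q x y ≡ p (x ∸ b) (y ∸ b)
    compLab-afterQ {x} {y} x<y k≤x = evaluate (<-≤-trans i<k k≤x) (<-≤-trans (s≤s k≤x) x<y)
      where
      evaluate : i < x → i + suc b < y → compLab i p (suc b) q x y ≡ p (x ∸ b) (y ∸ b)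
      evaluate i<x k<y rewrite unglued {y = y} (inj₁ (>⇒≢ i<x)) | ≤ᵇ-true (<⇒≤ i<x)
                             | ≤ᵇ-false k<y | ≤ᵇ-false i<x | ≤ᵇ-true k≤x
                             | ≤ᵇ-false (<-trans i<k k<y) | ≤ᵇ-true (<⇒≤ k<y) = refl

    compLab-intoQ : ∀ {x y} → x < i → i < y → y < i + suc b → compLab i p (suc b) q x y ≡ ε
    compLab-intoQ {x} {y} x<i i<y y<k
      rewrite unglued {y = y} (inj₁ (<⇒≢ x<i)) | ≤ᵇ-false x<i | ≤ᵇ-true (<⇒≤ x<i)
            | ≤ᵇ-false i<y | ≤ᵇ-false y<k = refl

    compLab-outOfQ : ∀ {x y} → i < x → x < i + suc b → i + suc b < y → compLab i p (suc b) q x y ≡ ε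
    compLab-outOfQ {x} {y} i<x x<k k<y
      rewrite unglued {y = y} (inj₁ (>⇒≢ i<x)) | ≤ᵇ-true (<⇒≤ i<x)
            | ≤ᵇ-false k<y | ≤ᵇ-false i<x | ≤ᵇ-false x<k = refl

  open Evaluation public

  ≈-resp-≡ : ∀ {x x′ y y′} → x ≡ x′ → y ≡ y′ → x′ ≈ y′ → x ≈ y
  ≈-resp-≡ refl refl x′≈y′ = x′≈y′

  infix 4 _≈[_]_
  _≈[_]_ : Labelling → ℕ → Labelling → Set ℓ
  p ≈[ n ] p′ = ∀ x y → x < y → y ≤ n → p x y ≈ p′ x y

  compLab-cong : ∀ {a b i} → i ≤ a → {p p′ q q′ : Labelling} →
                 p ≈[ suc a ] p′ → q ≈[ suc b ] q′ →
                 compLab i p (suc b) q ≈[ suc (a + b) ] compLab i p′ (suc b) q′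
  compLab-cong {a} {b} {i} i≤a {p} {p′} {q} {q′} p≈p′ q≈q′ x y x<y y≤n = go (arcPosition i b x y x<y)
    where
    b≤k : b ≤ i + suc b
    b≤k = ≤-trans (n≤1+n b) (m≤n+m (suc b) i)
    y∸b≤1+a : y ∸ b ≤ suc a
    y∸b≤1+a = m≤n+o⇒m∸o≤n y (suc a) y≤n
    module L = Evaluation i b p q
    module R = Evaluation i b p′ q′
    go : ArcPosition i b x y → compLab i p (suc b) q x y ≈ compLab i p′ (suc b) q′ x y
    go (glued refl refl) = ≈-resp-≡ L.compLab-glued R.compLab-glued
      (∙-cong (p≈p′ i (suc i) ≤-refl (s≤s i≤a)) (q≈q′ 0 (suc b) z<s ≤-refl))
    go (insideQ i≤x y≤k d) = ≈-resp-≡ (L.compLab-insideQ i≤x y≤k d) (R.compLab-insideQ i≤x y≤k d)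
      (q≈q′ (x ∸ i) (y ∸ i) (∸-monoˡ-< x<y i≤x) (m≤n+o⇒m∸n≤o y i y≤k))
    go (beforeQ y≤i) = ≈-resp-≡ (L.compLab-beforeQ x<y y≤i) (R.compLab-beforeQ x<y y≤i)
      (p≈p′ x y x<y (≤-trans y≤i (≤-trans i≤a (n≤1+n a))))
    go (overQ x≤i k≤y d) = ≈-resp-≡ (L.compLab-overQ x≤i k≤y d) (R.compLab-overQ x≤i k≤y d)
      (p≈p′ x (y ∸ b) (≤-<-trans x≤i (m+[1+n]≤o⇒m<o∸n i b k≤y)) y∸b≤1+a)
    go (afterQ k≤x) = ≈-resp-≡ (L.compLab-afterQ x<y k≤x) (R.compLab-afterQ x<y k≤x)
      (p≈p′ (x ∸ b) (y ∸ b) (∸-monoˡ-< x<y (≤-trans b≤k k≤x)) y∸b≤1+a)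
    go (intoQ x<i i<y y<k) = ≈-resp-≡ (L.compLab-intoQ x<i i<y y<k) (R.compLab-intoQ x<i i<y y<k) ≈-refl
    go (outOfQ i<x x<k k<y) = ≈-resp-≡ (L.compLab-outOfQ i<x x<k k<y) (R.compLab-outOfQ i<x x<k k<y) ≈-refl

  unit : Labelling
  unit _ _ = ε

  compLab-unitˡ : ∀ b (q : Labelling) → compLab 0 unit (suc b) q ≈[ suc b ] q
  compLab-unitˡ b q x y x<y y≤1+b with arcPosition 0 b x y x<y
  ... | glued refl refl = ≈-trans (reflexive (compLab-glued 0 b unit q)) (identityˡ _)
  ... | insideQ 0≤x y≤k d = reflexive (compLab-insideQ 0 b unit q 0≤x y≤k d)
  ... | beforeQ y≤0 = ⊥-elim (n≮0 (<-≤-trans x<y y≤0))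
  ... | overQ _ _ (inj₂ k<y) = ⊥-elim (<⇒≱ k<y y≤1+b)
  ... | afterQ k≤x = ⊥-elim (<⇒≱ (<-≤-trans x<y y≤1+b) k≤x)
  ... | outOfQ _ _ k<y = ⊥-elim (<⇒≱ k<y y≤1+b)

  compLab-unitʳ : ∀ i (p : Labelling) x y → x < y → compLab i p 1 unit x y ≈ p x y
  compLab-unitʳ i p x y x<y with arcPosition i 0 x y x<y
  ... | glued refl refl = begin
    compLab i p 1 unit i (i + 1) ≡⟨ compLab-glued i 0 p unit ⟩
    p i (suc i) ∙ ε              ≈⟨ identityʳ _ ⟩
    p i (suc i)                  ≡⟨ cong (p i) (sym (+-comm i 1)) ⟩
    p i (i + 1)                  ∎
    where open SetoidReasoning setoid
  ... | insideQ _ y≤i+1 (inj₁ i<x) = ⊥-elim (m<n⇒n≮m+1 i<x (<-≤-trans x<y y≤i+1))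
  ... | insideQ i≤x _ (inj₂ y<i+1) = ⊥-elim (m<n⇒n≮m+1 (≤-<-trans i≤x x<y) y<i+1)
  ... | beforeQ y≤i = reflexive (compLab-beforeQ i 0 p unit x<y y≤i)
  ... | overQ x≤i k≤y d = reflexive (compLab-overQ i 0 p unit x≤i k≤y d)
  ... | afterQ k≤x = reflexive (compLab-afterQ i 0 p unit x<y k≤x)
  ... | intoQ _ i<y y<i+1 = ⊥-elim (m<n⇒n≮m+1 i<y y<i+1)
  ... | outOfQ i<x x<i+1 _ = ⊥-elim (m<n⇒n≮m+1 i<x x<i+1)

  -- The only place where ⋆ would need to be associative: when Y has size 1 the glued arcs
  -- of X, Y and Z coincide, and the unit base label of Y makes up for it.
  assoc-glued : ∀ b c (X Y Z : Labelling) → (suc b ≡ 1 → Y 0 1 ≈ ε) → ∀ i j → j ≤ b →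
    compLab (i + j) (compLab i X (suc b) Y) (suc c) Z i (i + suc (b + c))
      ≈ compLab i X (suc (b + c)) (compLab j Y (suc c) Z) i (i + suc (b + c))
  assoc-glued zero c X Y Z Y-unit i zero z≤n rewrite +-identityʳ i = begin
    compLab i XY (suc c) Z i (i + suc c)  ≡⟨ compLab-glued i c XY Z ⟩
    XY i (suc i) ∙ Z 0 (suc c)            ≡⟨ cong (λ k → XY i k ∙ Z 0 (suc c)) (sym (+-comm i 1)) ⟩
    XY i (i + 1) ∙ Z 0 (suc c)            ≡⟨ cong (_∙ Z 0 (suc c)) (compLab-glued i 0 X Y) ⟩
    (X i (suc i) ∙ Y 0 1) ∙ Z 0 (suc c)   ≈⟨ ∙-cong (x∙Y₀₁≈x _) ≈-refl ⟩
    X i (suc i) ∙ Z 0 (suc c)             ≈⟨ ∙-cong ≈-refl (≈-sym (Y₀₁∙z≈z _)) ⟩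
    X i (suc i) ∙ (Y 0 1 ∙ Z 0 (suc c))   ≡⟨ cong (X i (suc i) ∙_) (sym (compLab-glued 0 c Y Z)) ⟩
    X i (suc i) ∙ YZ 0 (suc c)            ≡⟨ sym (compLab-glued i c X YZ) ⟩
    compLab i X (suc c) YZ i (i + suc c)  ∎
    where
    open SetoidReasoning setoid
    XY YZ : Labelling
    XY = compLab i X 1 Y
    YZ = compLab 0 Y (suc c) Z
    x∙Y₀₁≈x : ∀ x → x ∙ Y 0 1 ≈ x
    x∙Y₀₁≈x x = ≈-trans (∙-cong ≈-refl (Y-unit refl)) (identityʳ x)
    Y₀₁∙z≈z : ∀ z → Y 0 1 ∙ z ≈ z
    Y₀₁∙z≈z z = ≈-trans (∙-cong (Y-unit refl) ≈-refl) (identityˡ z)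
  assoc-glued (suc b) c X Y Z _ i j j≤b = reflexive (begin
    compLab (i + j) XY (suc c) Z i (i + suc (suc b + c))
      ≡⟨ compLab-overQ (i + j) c XY Z (m≤m+n i j) endZ≤endYZ (LHS-arc-unglued j) ⟩
    XY i (i + suc (suc b + c) ∸ c)      ≡⟨ cong (λ k → XY i (k ∸ c)) (sym (+-assoc i (suc (suc b)) c)) ⟩
    XY i (i + suc (suc b) + c ∸ c)      ≡⟨ cong (XY i) (m+n∸n≡m (i + suc (suc b)) c) ⟩
    XY i (i + suc (suc b))              ≡⟨ compLab-glued i (suc b) X Y ⟩
    X i (suc i) ∙ Y 0 (suc (suc b))
      ≡⟨ cong (λ k → X i (suc i) ∙ Y 0 k) (sym (m+n∸n≡m (suc (suc b)) c)) ⟩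
    X i (suc i) ∙ Y 0 (suc (suc b + c) ∸ c)
      ≡⟨ cong (X i (suc i) ∙_) (sym (compLab-overQ j c Y Z z≤n j+1+c≤2+b+c (YZ-arc-unglued j))) ⟩
    X i (suc i) ∙ YZ 0 (suc (suc b + c)) ≡⟨ sym (compLab-glued i (suc b + c) X YZ) ⟩
    compLab i X (suc (suc b + c)) YZ i (i + suc (suc b + c)) ∎)
    where
    open ≡-Reasoning
    XY YZ : Labelling
    XY = compLab i X (suc (suc b)) Y
    YZ = compLab j Y (suc c) Z
    j+1+c≤2+b+c : j + suc c ≤ suc (suc b + c)
    j+1+c≤2+b+c = subst (_≤ suc (suc b + c)) (sym (+-suc j c)) (s≤s (+-monoˡ-≤ c j≤b))
    endZ≤endYZ : i + j + suc c ≤ i + suc (suc b + c)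
    endZ≤endYZ = subst (_≤ i + suc (suc b + c)) (sym (+-assoc i j (suc c))) (+-monoʳ-≤ i j+1+c≤2+b+c)
    YZ-arc-unglued : ∀ j → 0 < j ⊎ j + suc c < suc (suc b + c)
    YZ-arc-unglued zero = inj₂ (s≤s (s≤s (m≤n+m c b)))
    YZ-arc-unglued (suc _) = inj₁ z<s
    LHS-arc-unglued : ∀ j → i < i + j ⊎ i + j + suc c < i + suc (suc b + c)
    LHS-arc-unglued zero = inj₂ (subst (_< i + suc (suc b + c)) (cong (_+ suc c) (sym (+-identityʳ i)))
                                    (+-monoʳ-< i (s≤s (s≤s (m≤n+m c b)))))
    LHS-arc-unglued (suc _) = inj₁ (m<m+n i z<s)

  module Associativity (b c : ℕ) (X Y Z : Labelling) (i j : ℕ) (j≤b : j ≤ b) where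
    XY YZ LHS RHS : Labelling
    XY = compLab i X (suc b) Y
    YZ = compLab j Y (suc c) Z
    LHS = compLab (i + j) XY (suc c) Z
    RHS = compLab i X (suc (b + c)) YZ

    module OnLHS = Evaluation (i + j) c XY Z
    module OnXY = Evaluation i b X Y
    module OnRHS = Evaluation i (b + c) X YZ
    module OnYZ = Evaluation j c Y Z

    endY endZ endYZ : ℕ
    endY = i + suc b
    endZ = i + j + suc c
    endYZ = i + suc (b + c)

    i≤i+j : i ≤ i + j
    i≤i+j = m≤m+n i j

    i+j<endY : i + j < endY
    i+j<endY = +-monoʳ-< i (s≤s j≤b)

    endZ≡i+[j+1+c] : endZ ≡ i + (j + suc c)
    endZ≡i+[j+1+c] = +-assoc i j (suc c)

    endZ≤endYZ : endZ ≤ endYZ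
    endZ≤endYZ = subst (_≤ endYZ) (sym endZ≡i+[j+1+c])
      (+-monoʳ-≤ i (subst (_≤ suc (b + c)) (sym (+-suc j c)) (s≤s (+-monoˡ-≤ c j≤b))))

    c≤endZ : c ≤ endZ
    c≤endZ = ≤-trans (n≤1+n c) (m≤n+m (suc c) (i + j))

    c≤endYZ : c ≤ endYZ
    c≤endYZ = ≤-trans c≤endZ endZ≤endYZ

    endYZ∸c≡endY : endYZ ∸ c ≡ endY
    endYZ∸c≡endY = trans (cong (_∸ c) (sym (+-assoc i (suc b) c))) (m+n∸n≡m endY c)

    endYZ≤⇒endY≤∸c : ∀ {w} → endYZ ≤ w → endY ≤ w ∸ c
    endYZ≤⇒endY≤∸c {w} endYZ≤w = subst (_≤ w ∸ c) endYZ∸c≡endY (∸-monoˡ-≤ c endYZ≤w)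

    endYZ<⇒endY<∸c : ∀ {w} → endYZ < w → endY < w ∸ c
    endYZ<⇒endY<∸c {w} endYZ<w = subst (_< w ∸ c) endYZ∸c≡endY (∸-monoˡ-< endYZ<w c≤endYZ)

    ≤endYZ⇒∸c≤endY : ∀ {w} → w ≤ endYZ → w ∸ c ≤ endY
    ≤endYZ⇒∸c≤endY {w} w≤endYZ = subst (w ∸ c ≤_) endYZ∸c≡endY (∸-monoˡ-≤ c w≤endYZ)

    <endYZ⇒∸c<endY : ∀ {w} → c ≤ w → w < endYZ → w ∸ c < endY
    <endYZ⇒∸c<endY {w} c≤w w<endYZ = subst (w ∸ c <_) endYZ∸c≡endY (∸-monoˡ-< w<endYZ c≤w)

    endZ≤⇒i+j<∸c : ∀ {w} → endZ ≤ w → i + j < w ∸ c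
    endZ≤⇒i+j<∸c {w} endZ≤w = subst (_≤ w ∸ c) (m+[1+n]∸n≡1+m (i + j) c) (∸-monoˡ-≤ c endZ≤w)

    endZ≤⇒i<∸c : ∀ {w} → endZ ≤ w → i < w ∸ c
    endZ≤⇒i<∸c endZ≤w = ≤-<-trans i≤i+j (endZ≤⇒i+j<∸c endZ≤w)

    assoc-beforeQ : ∀ {u v} → u < v → v ≤ i → LHS u v ≡ RHS u v
    assoc-beforeQ u<v v≤i = trans (OnLHS.compLab-beforeQ u<v (≤-trans v≤i i≤i+j))
      (trans (OnXY.compLab-beforeQ u<v v≤i) (sym (OnRHS.compLab-beforeQ u<v v≤i)))

    assoc-afterQ : ∀ {u v} → u < v → endYZ ≤ u → LHS u v ≡ RHS u v
    assoc-afterQ {u} {v} u<v endYZ≤u = trans (OnLHS.compLab-afterQ u<v (≤-trans endZ≤endYZ endYZ≤u))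
      (trans (OnXY.compLab-afterQ (∸-monoˡ-< u<v (≤-trans c≤endYZ endYZ≤u)) (endYZ≤⇒endY≤∸c endYZ≤u))
      (trans (cong₂ X (m∸n∸o≡m∸[o+n] u c b) (m∸n∸o≡m∸[o+n] v c b))
      (sym (OnRHS.compLab-afterQ u<v endYZ≤u))))

    assoc-overQ : ∀ {u v} → u ≤ i → endYZ ≤ v → u < i ⊎ endYZ < v → LHS u v ≡ RHS u v
    assoc-overQ {u} {v} u≤i endYZ≤v d = trans
      (OnLHS.compLab-overQ (≤-trans u≤i i≤i+j) (≤-trans endZ≤endYZ endYZ≤v)
        (⊎-map (λ u<i → <-≤-trans u<i i≤i+j) (≤-<-trans endZ≤endYZ) d))
      (trans (OnXY.compLab-overQ u≤i (endYZ≤⇒endY≤∸c endYZ≤v) (⊎-map id endYZ<⇒endY<∸c d))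
      (trans (cong (X u) (m∸n∸o≡m∸[o+n] v c b)) (sym (OnRHS.compLab-overQ u≤i endYZ≤v d))))

    assoc-intoQ : ∀ {u v} → u < v → u < i → i < v → v < endYZ → LHS u v ≡ RHS u v
    assoc-intoQ {u} {v} u<v u<i i<v v<endYZ =
      trans (LHS≡ε (v ≤? i + j) (endZ ≤? v)) (sym (OnRHS.compLab-intoQ u<i i<v v<endYZ))
      where
      u<i+j : u < i + j
      u<i+j = <-≤-trans u<i i≤i+j
      LHS≡ε : Dec (v ≤ i + j) → Dec (endZ ≤ v) → LHS u v ≡ ε
      LHS≡ε (yes v≤i+j) _ = trans (OnLHS.compLab-beforeQ u<v v≤i+j)
        (OnXY.compLab-intoQ u<i i<v (≤-<-trans v≤i+j i+j<endY))
      LHS≡ε (no v≰i+j) (no v≱endZ) = OnLHS.compLab-intoQ u<i+j (≰⇒> v≰i+j) (≰⇒> v≱endZ)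
      LHS≡ε (no _) (yes endZ≤v) = trans (OnLHS.compLab-overQ (<⇒≤ u<i+j) endZ≤v (inj₁ u<i+j))
        (OnXY.compLab-intoQ u<i (endZ≤⇒i<∸c endZ≤v) (<endYZ⇒∸c<endY (≤-trans c≤endZ endZ≤v) v<endYZ))

    assoc-outOfQ : ∀ {u v} → u < v → i < u → u < endYZ → endYZ < v → LHS u v ≡ RHS u v
    assoc-outOfQ {u} {v} u<v i<u u<endYZ endYZ<v =
      trans (LHS≡ε (u ≤? i + j) (endZ ≤? u)) (sym (OnRHS.compLab-outOfQ i<u u<endYZ endYZ<v))
      where
      endZ<v : endZ < v
      endZ<v = ≤-<-trans endZ≤endYZ endYZ<v
      LHS≡ε : Dec (u ≤ i + j) → Dec (endZ ≤ u) → LHS u v ≡ ε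
      LHS≡ε (yes u≤i+j) _ = trans (OnLHS.compLab-overQ u≤i+j (<⇒≤ endZ<v) (inj₂ endZ<v))
        (OnXY.compLab-outOfQ i<u (≤-<-trans u≤i+j i+j<endY) (endYZ<⇒endY<∸c endYZ<v))
      LHS≡ε (no u≰i+j) (no u≱endZ) = OnLHS.compLab-outOfQ (≰⇒> u≰i+j) (≰⇒> u≱endZ) endZ<v
      LHS≡ε (no _) (yes endZ≤u) = trans (OnLHS.compLab-afterQ u<v endZ≤u)
        (OnXY.compLab-outOfQ (endZ≤⇒i<∸c endZ≤u) (<endYZ⇒∸c<endY (≤-trans c≤endZ endZ≤u) u<endYZ)
          (endYZ<⇒endY<∸c endYZ<v))

    assoc-insideQ : ∀ {u v} → u < v → i ≤ u → v ≤ endYZ → i < u ⊎ v < endYZ → LHS u v ≡ RHS u v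
    assoc-insideQ {u} {v} u<v i≤u v≤endYZ d =
      trans (LHS≡YZ (arcPosition (i + j) c u v u<v)) (sym (OnRHS.compLab-insideQ i≤u v≤endYZ d))
      where
      i≤v : i ≤ v
      i≤v = ≤-trans i≤u (<⇒≤ u<v)
      u∸i<v∸i : u ∸ i < v ∸ i
      u∸i<v∸i = ∸-monoˡ-< u<v i≤u
      endZ≤i+[j+1+c] : endZ ≤ i + (j + suc c)
      endZ≤i+[j+1+c] = ≤-reflexive endZ≡i+[j+1+c]
      i+[j+1+c]≤endZ : i + (j + suc c) ≤ endZ
      i+[j+1+c]≤endZ = ≤-reflexive (sym endZ≡i+[j+1+c])
      endZ<endYZ⇒1+i+j<endY : endZ < endYZ → suc (i + j) < endY
      endZ<endYZ⇒1+i+j<endY endZ<endYZ =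
        subst₂ _≤_ (m+[1+n]∸n≡1+m (suc (i + j)) c) endYZ∸c≡endY (∸-monoˡ-≤ c endZ<endYZ)

      1+i+j∸i≡1+j : suc (i + j) ∸ i ≡ suc j
      1+i+j∸i≡1+j = trans (cong (_∸ i) (sym (+-suc i j))) (m+n∸m≡n i (suc j))

      LHS≡YZ : ArcPosition (i + j) c u v → LHS u v ≡ YZ (u ∸ i) (v ∸ i)
      LHS≡YZ (glued refl refl) = begin
        LHS (i + j) endZ                      ≡⟨ OnLHS.compLab-glued ⟩
        XY (i + j) (suc (i + j)) ∙ Z 0 (suc c)
          ≡⟨ cong (_∙ Z 0 (suc c)) (OnXY.compLab-insideQ i≤i+j i+j<endY (⊎-map id endZ<endYZ⇒1+i+j<endY d)) ⟩
        Y (i + j ∸ i) (suc (i + j) ∸ i) ∙ Z 0 (suc c)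
          ≡⟨ cong (_∙ Z 0 (suc c)) (cong₂ Y (m+n∸m≡n i j) 1+i+j∸i≡1+j) ⟩
        Y j (suc j) ∙ Z 0 (suc c)             ≡⟨ sym (OnYZ.compLab-glued) ⟩
        YZ j (j + suc c)
          ≡⟨ sym (cong₂ YZ (m+n∸m≡n i j) (trans (cong (_∸ i) endZ≡i+[j+1+c]) (m+n∸m≡n i (j + suc c)))) ⟩
        YZ (i + j ∸ i) (endZ ∸ i)             ∎
        where open ≡-Reasoning
      LHS≡YZ (insideQ i+j≤u v≤endZ d′) = trans (OnLHS.compLab-insideQ i+j≤u v≤endZ d′)
        (trans (cong₂ Z (sym (∸-+-assoc u i j)) (sym (∸-+-assoc v i j)))
        (sym (OnYZ.compLab-insideQ (m+n≤o⇒n≤o∸m i i+j≤u) (m≤n+o⇒m∸n≤o v i (≤-trans v≤endZ endZ≤i+[j+1+c]))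
          (⊎-map (m+n<o⇒n<o∸m i) (λ v<endZ → n≤m<n+o⇒m∸n<o i≤v (<-≤-trans v<endZ endZ≤i+[j+1+c])) d′))))
      LHS≡YZ (beforeQ v≤i+j) = trans (OnLHS.compLab-beforeQ u<v v≤i+j)
        (trans (OnXY.compLab-insideQ i≤u (≤-trans v≤i+j (<⇒≤ i+j<endY)) (inj₂ (≤-<-trans v≤i+j i+j<endY)))
        (sym (OnYZ.compLab-beforeQ u∸i<v∸i (m≤n+o⇒m∸n≤o v i v≤i+j))))
      LHS≡YZ (overQ u≤i+j endZ≤v d′) = trans (OnLHS.compLab-overQ u≤i+j endZ≤v d′)
        (trans (OnXY.compLab-insideQ i≤u (≤endYZ⇒∸c≤endY v≤endYZ)
                 (⊎-map id (<endYZ⇒∸c<endY (≤-trans c≤endZ endZ≤v)) d))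
        (trans (cong (Y (u ∸ i)) (m∸n∸o≡m∸o∸n v c i))
        (sym (OnYZ.compLab-overQ (m≤n+o⇒m∸n≤o u i u≤i+j) (m+n≤o⇒n≤o∸m i (≤-trans i+[j+1+c]≤endZ endZ≤v))
          (⊎-map (n≤m<n+o⇒m∸n<o i≤u) (λ endZ<v → m+n<o⇒n<o∸m i (≤-<-trans i+[j+1+c]≤endZ endZ<v)) d′)))))
      LHS≡YZ (afterQ endZ≤u) = trans (OnLHS.compLab-afterQ u<v endZ≤u)
        (trans (OnXY.compLab-insideQ (<⇒≤ (endZ≤⇒i<∸c endZ≤u)) (≤endYZ⇒∸c≤endY v≤endYZ)
                                     (inj₁ (endZ≤⇒i<∸c endZ≤u)))
        (trans (cong₂ Y (m∸n∸o≡m∸o∸n u c i) (m∸n∸o≡m∸o∸n v c i))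
        (sym (OnYZ.compLab-afterQ u∸i<v∸i (m+n≤o⇒n≤o∸m i (≤-trans i+[j+1+c]≤endZ endZ≤u))))))
      LHS≡YZ (intoQ u<i+j i+j<v v<endZ) = trans (OnLHS.compLab-intoQ u<i+j i+j<v v<endZ)
        (sym (OnYZ.compLab-intoQ (n≤m<n+o⇒m∸n<o i≤u u<i+j) (m+n<o⇒n<o∸m i i+j<v)
          (n≤m<n+o⇒m∸n<o i≤v (<-≤-trans v<endZ endZ≤i+[j+1+c]))))
      LHS≡YZ (outOfQ i+j<u u<endZ endZ<v) = trans (OnLHS.compLab-outOfQ i+j<u u<endZ endZ<v)
        (sym (OnYZ.compLab-outOfQ (m+n<o⇒n<o∸m i i+j<u) (n≤m<n+o⇒m∸n<o i≤u (<-≤-trans u<endZ endZ≤i+[j+1+c]))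
          (m+n<o⇒n<o∸m i (≤-<-trans i+[j+1+c]≤endZ endZ<v))))

    LHS≈RHS : (suc b ≡ 1 → Y 0 1 ≈ ε) → ∀ u v → u < v → LHS u v ≈ RHS u v
    LHS≈RHS Y-unit u v u<v with arcPosition i (b + c) u v u<v
    ... | glued refl refl = assoc-glued b c X Y Z Y-unit i j j≤b
    ... | insideQ i≤u v≤e d = reflexive (assoc-insideQ u<v i≤u v≤e d)
    ... | beforeQ v≤i = reflexive (assoc-beforeQ u<v v≤i)
    ... | overQ u≤i e≤v d = reflexive (assoc-overQ u≤i e≤v d)
    ... | afterQ e≤u = reflexive (assoc-afterQ u<v e≤u)
    ... | intoQ u<i i<v v<e = reflexive (assoc-intoQ u<v u<i i<v v<e)
    ... | outOfQ i<u u<e e<v = reflexive (assoc-outOfQ u<v i<u u<e e<v)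

  compLab-assoc : ∀ b c (X Y Z : Labelling) → (suc b ≡ 1 → Y 0 1 ≈ ε) →
                  ∀ i j → j ≤ b → ∀ u v → u < v →
    compLab (i + j) (compLab i X (suc b) Y) (suc c) Z u v
      ≈ compLab i X (suc (b + c)) (compLab j Y (suc c) Z) u v
  compLab-assoc b c X Y Z Y-unit i j j≤b = Associativity.LHS≈RHS b c X Y Z i j j≤b Y-unit

  module Commutativity (b c : ℕ) (X Y Z : Labelling) (i j : ℕ) (i<j : i < j) where
    XY XZ LHS RHS : Labelling
    XY = compLab i X (suc b) Y
    XZ = compLab j X (suc c) Z
    LHS = compLab (j + b) XY (suc c) Z
    RHS = compLab i XZ (suc b) Y

    module OnLHS = Evaluation (j + b) c XY Z
    module OnXY = Evaluation i b X Y
    module OnRHS = Evaluation i b XZ Y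
    module OnXZ = Evaluation j c X Z

    endY endZ : ℕ
    endY = i + suc b
    endZ = j + b + suc c

    i<endY : i < endY
    i<endY = m<m+n i z<s

    endY≤j+b : endY ≤ j + b
    endY≤j+b = subst (_≤ j + b) (sym (+-suc i b)) (+-monoˡ-≤ b i<j)

    b≤endY : b ≤ endY
    b≤endY = ≤-trans (n≤1+n b) (m≤n+m (suc b) i)

    c≤endZ : c ≤ endZ
    c≤endZ = ≤-trans (n≤1+n c) (m≤n+m (suc c) (j + b))

    endZ≡j+[1+c]+b : endZ ≡ j + suc c + b
    endZ≡j+[1+c]+b = +-rcomm j b (suc c)

    endZ≤⇒j+b<∸c : ∀ {w} → endZ ≤ w → j + b < w ∸ c
    endZ≤⇒j+b<∸c {w} endZ≤w = subst (_≤ w ∸ c) (m+[1+n]∸n≡1+m (j + b) c) (∸-monoˡ-≤ c endZ≤w)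

    endZ≤⇒j+1+c≤∸b : ∀ {w} → endZ ≤ w → j + suc c ≤ w ∸ b
    endZ≤⇒j+1+c≤∸b {w} endZ≤w = m+n≤o⇒m≤o∸n (j + suc c) (subst (_≤ w) endZ≡j+[1+c]+b endZ≤w)

    endZ<⇒j+1+c<∸b : ∀ {w} → endZ < w → j + suc c < w ∸ b
    endZ<⇒j+1+c<∸b {w} endZ<w = m+n≤o⇒m≤o∸n (suc (j + suc c)) (subst (_< w) endZ≡j+[1+c]+b endZ<w)

    ≤endZ⇒∸b≤j+1+c : ∀ {w} → w ≤ endZ → w ∸ b ≤ j + suc c
    ≤endZ⇒∸b≤j+1+c {w} w≤endZ = m≤n+o⇒m∸o≤n w (j + suc c) (subst (w ≤_) endZ≡j+[1+c]+b w≤endZ)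

    <endZ⇒∸b<j+1+c : ∀ {w} → b ≤ w → w < endZ → w ∸ b < j + suc c
    <endZ⇒∸b<j+1+c {w} b≤w w<endZ = n≤m<o+n⇒m∸n<o b≤w (subst (w <_) endZ≡j+[1+c]+b w<endZ)

    comm-glued : LHS i endY ≡ RHS i endY
    comm-glued = trans (OnLHS.compLab-beforeQ i<endY endY≤j+b) (trans (OnXY.compLab-glued)
      (sym (trans (OnRHS.compLab-glued) (cong (_∙ Y 0 (suc b)) (OnXZ.compLab-beforeQ (n<1+n i) i<j)))))

    comm-insideQ : ∀ {u v} → u < v → i ≤ u → v ≤ endY → i < u ⊎ v < endY → LHS u v ≡ RHS u v
    comm-insideQ u<v i≤u v≤endY d = trans (OnLHS.compLab-beforeQ u<v (≤-trans v≤endY endY≤j+b))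
      (trans (OnXY.compLab-insideQ i≤u v≤endY d) (sym (OnRHS.compLab-insideQ i≤u v≤endY d)))

    comm-beforeQ : ∀ {u v} → u < v → v ≤ i → LHS u v ≡ RHS u v
    comm-beforeQ u<v v≤i = trans (OnLHS.compLab-beforeQ u<v (≤-trans v≤i (≤-trans (<⇒≤ i<endY) endY≤j+b)))
      (trans (OnXY.compLab-beforeQ u<v v≤i)
      (sym (trans (OnRHS.compLab-beforeQ u<v v≤i) (OnXZ.compLab-beforeQ u<v (≤-trans v≤i (<⇒≤ i<j))))))

    comm-intoQ : ∀ {u v} → u < v → u < i → i < v → v < endY → LHS u v ≡ RHS u v
    comm-intoQ u<v u<i i<v v<endY = trans (OnLHS.compLab-beforeQ u<v (≤-trans (<⇒≤ v<endY) endY≤j+b))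
      (trans (OnXY.compLab-intoQ u<i i<v v<endY) (sym (OnRHS.compLab-intoQ u<i i<v v<endY)))

    comm-outOfQ : ∀ {u v} → u < v → i < u → u < endY → endY < v → LHS u v ≡ RHS u v
    comm-outOfQ {u} {v} u<v i<u u<endY endY<v =
      trans (LHS≡ε (v ≤? j + b) (endZ ≤? v)) (sym (OnRHS.compLab-outOfQ i<u u<endY endY<v))
      where
      u<j+b : u < j + b
      u<j+b = <-≤-trans u<endY endY≤j+b
      LHS≡ε : Dec (v ≤ j + b) → Dec (endZ ≤ v) → LHS u v ≡ ε
      LHS≡ε (yes v≤j+b) _ = trans (OnLHS.compLab-beforeQ u<v v≤j+b) (OnXY.compLab-outOfQ i<u u<endY endY<v)
      LHS≡ε (no v≰j+b) (no v≱endZ) = OnLHS.compLab-intoQ u<j+b (≰⇒> v≰j+b) (≰⇒> v≱endZ)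
      LHS≡ε (no _) (yes endZ≤v) = trans (OnLHS.compLab-overQ (<⇒≤ u<j+b) endZ≤v (inj₁ u<j+b))
        (OnXY.compLab-outOfQ i<u u<endY (≤-<-trans endY≤j+b (endZ≤⇒j+b<∸c endZ≤v)))

    comm-overQ : ∀ {u v} → u < v → u ≤ i → endY ≤ v → u < i ⊎ endY < v → LHS u v ≡ RHS u v
    comm-overQ {u} {v} u<v u≤i endY≤v d =
      trans (LHS≡XZ (v ≤? j + b) (endZ ≤? v)) (sym (OnRHS.compLab-overQ u≤i endY≤v d))
      where
      u<j : u < j
      u<j = ≤-<-trans u≤i i<j
      u<j+b : u < j + b
      u<j+b = <-≤-trans u<j (m≤m+n j b)
      b≤v : b ≤ v
      b≤v = ≤-trans b≤endY endY≤v
      LHS≡XZ : Dec (v ≤ j + b) → Dec (endZ ≤ v) → LHS u v ≡ XZ u (v ∸ b)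
      LHS≡XZ (yes v≤j+b) _ = trans (OnLHS.compLab-beforeQ u<v v≤j+b) (trans (OnXY.compLab-overQ u≤i endY≤v d)
        (sym (OnXZ.compLab-beforeQ (≤-<-trans u≤i (m+[1+n]≤o⇒m<o∸n i b endY≤v)) (m≤n+o⇒m∸o≤n v j v≤j+b))))
      LHS≡XZ (no v≰j+b) (no v≱endZ) = trans (OnLHS.compLab-intoQ u<j+b (≰⇒> v≰j+b) (≰⇒> v≱endZ))
        (sym (OnXZ.compLab-intoQ u<j (m+n≤o⇒m≤o∸n (suc j) (≰⇒> v≰j+b)) (<endZ⇒∸b<j+1+c b≤v (≰⇒> v≱endZ))))
      LHS≡XZ (no _) (yes endZ≤v) = trans (OnLHS.compLab-overQ (<⇒≤ u<j+b) endZ≤v (inj₁ u<j+b))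
        (trans (OnXY.compLab-overQ u≤i (<⇒≤ endY<v∸c) (inj₂ endY<v∸c))
        (trans (cong (X u) (m∸n∸o≡m∸o∸n v c b))
        (sym (OnXZ.compLab-overQ (<⇒≤ u<j) (endZ≤⇒j+1+c≤∸b endZ≤v) (inj₁ u<j)))))
        where
        endY<v∸c : endY < v ∸ c
        endY<v∸c = ≤-<-trans endY≤j+b (endZ≤⇒j+b<∸c endZ≤v)

    comm-afterQ : ∀ {u v} → u < v → endY ≤ u → LHS u v ≡ RHS u v
    comm-afterQ {u} {v} u<v endY≤u =
      trans (LHS≡XZ (arcPosition (j + b) c u v u<v)) (sym (OnRHS.compLab-afterQ u<v endY≤u))
      where
      b≤u : b ≤ u
      b≤u = ≤-trans b≤endY endY≤u
      b≤v : b ≤ v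
      b≤v = ≤-trans b≤u (<⇒≤ u<v)
      u∸b<v∸b : u ∸ b < v ∸ b
      u∸b<v∸b = ∸-monoˡ-< u<v b≤u
      LHS≡XZ : ArcPosition (j + b) c u v → LHS u v ≡ XZ (u ∸ b) (v ∸ b)
      LHS≡XZ (glued refl refl) = begin
        LHS (j + b) endZ                          ≡⟨ OnLHS.compLab-glued ⟩
        XY (j + b) (suc (j + b)) ∙ Z 0 (suc c)
          ≡⟨ cong (_∙ Z 0 (suc c)) (OnXY.compLab-afterQ (n<1+n (j + b)) endY≤j+b) ⟩
        X (j + b ∸ b) (suc j + b ∸ b) ∙ Z 0 (suc c)
          ≡⟨ cong (_∙ Z 0 (suc c)) (cong₂ X (m+n∸n≡m j b) (m+n∸n≡m (suc j) b)) ⟩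
        X j (suc j) ∙ Z 0 (suc c)                 ≡⟨ sym (OnXZ.compLab-glued) ⟩
        XZ j (j + suc c)
          ≡⟨ sym (cong₂ XZ (m+n∸n≡m j b) (trans (cong (_∸ b) endZ≡j+[1+c]+b) (m+n∸n≡m (j + suc c) b))) ⟩
        XZ (j + b ∸ b) (endZ ∸ b)                 ∎
        where open ≡-Reasoning
      LHS≡XZ (insideQ j+b≤u v≤endZ d) = trans (OnLHS.compLab-insideQ j+b≤u v≤endZ d)
        (trans (cong₂ Z (sym (m∸n∸o≡m∸[o+n] u b j)) (sym (m∸n∸o≡m∸[o+n] v b j)))
        (sym (OnXZ.compLab-insideQ (m+n≤o⇒m≤o∸n j j+b≤u) (≤endZ⇒∸b≤j+1+c v≤endZ)
          (⊎-map (m+n≤o⇒m≤o∸n (suc j)) (<endZ⇒∸b<j+1+c b≤v) d))))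
      LHS≡XZ (beforeQ v≤j+b) = trans (OnLHS.compLab-beforeQ u<v v≤j+b) (trans (OnXY.compLab-afterQ u<v endY≤u)
        (sym (OnXZ.compLab-beforeQ u∸b<v∸b (m≤n+o⇒m∸o≤n v j v≤j+b))))
      LHS≡XZ (overQ u≤j+b endZ≤v d) = trans (OnLHS.compLab-overQ u≤j+b endZ≤v d)
        (trans (OnXY.compLab-afterQ (<-≤-trans (s≤s u≤j+b) (endZ≤⇒j+b<∸c endZ≤v)) endY≤u)
        (trans (cong (X (u ∸ b)) (m∸n∸o≡m∸o∸n v c b))
        (sym (OnXZ.compLab-overQ (m≤n+o⇒m∸o≤n u j u≤j+b) (endZ≤⇒j+1+c≤∸b endZ≤v)
          (⊎-map (n≤m<o+n⇒m∸n<o b≤u) endZ<⇒j+1+c<∸b d)))))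
      LHS≡XZ (afterQ endZ≤u) = trans (OnLHS.compLab-afterQ u<v endZ≤u)
        (trans (OnXY.compLab-afterQ (∸-monoˡ-< u<v (≤-trans c≤endZ endZ≤u))
                 (≤-trans endY≤j+b (<⇒≤ (endZ≤⇒j+b<∸c endZ≤u))))
        (trans (cong₂ X (m∸n∸o≡m∸o∸n u c b) (m∸n∸o≡m∸o∸n v c b))
        (sym (OnXZ.compLab-afterQ u∸b<v∸b (endZ≤⇒j+1+c≤∸b endZ≤u)))))
      LHS≡XZ (intoQ u<j+b j+b<v v<endZ) = trans (OnLHS.compLab-intoQ u<j+b j+b<v v<endZ)
        (sym (OnXZ.compLab-intoQ (n≤m<o+n⇒m∸n<o b≤u u<j+b) (m+n≤o⇒m≤o∸n (suc j) j+b<v)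
                                 (<endZ⇒∸b<j+1+c b≤v v<endZ)))
      LHS≡XZ (outOfQ j+b<u u<endZ endZ<v) = trans (OnLHS.compLab-outOfQ j+b<u u<endZ endZ<v)
        (sym (OnXZ.compLab-outOfQ (m+n≤o⇒m≤o∸n (suc j) j+b<u) (<endZ⇒∸b<j+1+c b≤u u<endZ)
                                  (endZ<⇒j+1+c<∸b endZ<v)))

    LHS≡RHS : ∀ u v → u < v → LHS u v ≡ RHS u v
    LHS≡RHS u v u<v with arcPosition i b u v u<v
    ... | glued refl refl = comm-glued
    ... | insideQ i≤u v≤endY d = comm-insideQ u<v i≤u v≤endY d
    ... | beforeQ v≤i = comm-beforeQ u<v v≤i
    ... | overQ u≤i endY≤v d = comm-overQ u<v u≤i endY≤v d
    ... | afterQ endY≤u = comm-afterQ u<v endY≤u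
    ... | intoQ u<i i<v v<endY = comm-intoQ u<v u<i i<v v<endY
    ... | outOfQ i<u u<endY endY<v = comm-outOfQ u<v i<u u<endY endY<v

  compLab-comm : ∀ b c (X Y Z : Labelling) i j → i < j → ∀ u v → u < v →
    compLab (j + b) (compLab i X (suc b) Y) (suc c) Z u v
      ≡ compLab i (compLab j X (suc c) Z) (suc b) Y u v
  compLab-comm b c X Y Z i j i<j = Commutativity.LHS≡RHS b c X Y Z i j i<j

  lab-subst : ∀ {n n′} (e : n ≡ n′) (p : Clique n) x y → lab (subst Clique e p) x y ≡ lab p x y
  lab-subst refl p x y = refl

  ∘-unitʳ : ∀ {a} (x : Clique (suc a)) (i : Fin (suc a)) →
            subst Clique (cong suc (+-identityʳ a)) (x ∘⟨ i ⟩ 𝐮) ≈C x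
  ∘-unitʳ {a} x i u v u<v _ = ≈-resp-≡ (lab-subst (cong suc (+-identityʳ a)) (x ∘⟨ i ⟩ 𝐮) u v) refl
    (compLab-unitʳ (toℕ i) (lab x) u v u<v)

  ∘-assoc : ∀ {a b c} (x : Clique (suc a)) (y : Clique (suc b)) (z : Clique (suc c))
            (i : Fin (suc a)) (j : Fin (suc b)) →
            subst Clique (cong suc (+-assoc a b c)) ((x ∘⟨ i ⟩ y) ∘⟨ i ⊕ j ⟩ z)
              ≈C (x ∘⟨ i ⟩ (y ∘⟨ j ⟩ z))
  ∘-assoc {a} {b} {c} x y z i j u v u<v _ = ≈-resp-≡
    (trans (lab-subst (cong suc (+-assoc a b c)) ((x ∘⟨ i ⟩ y) ∘⟨ i ⊕ j ⟩ z) u v)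
           (cong (λ k → compLab k (lab (x ∘⟨ i ⟩ y)) (suc c) (lab z) u v) (toℕ-⊕ i j)))
    refl
    (compLab-assoc b c (lab x) (lab y) (lab z) (base-unit y) (toℕ i) (toℕ j) (toℕ≤pred[n] j) u v u<v)

  ∘-comm : ∀ {a b c} (x : Clique (suc a)) (y : Clique (suc b)) (z : Clique (suc c))
           (i j : Fin (suc a)) → i <ᶠ j →
           subst Clique (cong suc (+-rcomm a b c)) ((x ∘⟨ i ⟩ y) ∘⟨ shiftBy b j ⟩ z)
             ≈C ((x ∘⟨ j ⟩ z) ∘⟨ i ↑ˡ c ⟩ y)
  ∘-comm {a} {b} {c} x y z i j i<j u v u<v _ = reflexive (begin
    lab (subst Clique (cong suc (+-rcomm a b c)) ((x ∘⟨ i ⟩ y) ∘⟨ shiftBy b j ⟩ z)) u v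
      ≡⟨ lab-subst (cong suc (+-rcomm a b c)) ((x ∘⟨ i ⟩ y) ∘⟨ shiftBy b j ⟩ z) u v ⟩
    compLab (toℕ (shiftBy b j)) (lab (x ∘⟨ i ⟩ y)) (suc c) (lab z) u v
      ≡⟨ cong (λ k → compLab k (lab (x ∘⟨ i ⟩ y)) (suc c) (lab z) u v) (toℕ-shiftBy b j) ⟩
    compLab (toℕ j + b) (lab (x ∘⟨ i ⟩ y)) (suc c) (lab z) u v
      ≡⟨ compLab-comm b c (lab x) (lab y) (lab z) (toℕ i) (toℕ j) i<j u v u<v ⟩
    compLab (toℕ i) (lab (x ∘⟨ j ⟩ z)) (suc b) (lab y) u v
      ≡⟨ cong (λ k → compLab k (lab (x ∘⟨ j ⟩ z)) (suc b) (lab y) u v) (sym (toℕ-↑ˡ i c)) ⟩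
    lab ((x ∘⟨ j ⟩ z) ∘⟨ i ↑ˡ c ⟩ y) u v ∎)
    where open ≡-Reasoning

  C-isOperad : CIsOperad M
  C-isOperad = record
    { isEquivalence = record
      { refl = λ _ _ _ _ → ≈-refl
      ; sym = λ p≈q x y x<y y≤n → ≈-sym (p≈q x y x<y y≤n)
      ; trans = λ p≈q q≈r x y x<y y≤n → ≈-trans (p≈q x y x<y y≤n) (q≈r x y x<y y≤n)
      }
    ; ∘-cong = λ {_} {_} {x} {x′} {y} {y′} i →
        compLab-cong (toℕ≤pred[n] i) {lab x} {lab x′} {lab y} {lab y′}
    ; unitˡ = λ {b} y → compLab-unitˡ b (lab y)
    ; unitʳ = ∘-unitʳ
    ; assoc = ∘-assoc
    ; comm = ∘-comm
    }

module _ {c₁ ℓ₁ c₂ ℓ₂ : Level} (M₁ : UnitalMagma c₁ ℓ₁) (M₂ : UnitalMagma c₂ ℓ₂)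
         (φ : UnitalMagma.Carrier M₁ → UnitalMagma.Carrier M₂)
         (φ-hom : IsUnitalMagmaMorphism {M₁ = M₁} {M₂ = M₂} φ) where
  private
    module M₁ = UnitalMagma M₁
    module M₂ = UnitalMagma M₂
    module C₁ = Cliques M₁
    module C₂ = Cliques M₂
    module K₁ = CliqueComposition M₁
    module K₂ = CliqueComposition M₂
    open IsMonoidHomomorphism φ-hom using (homo; ε-homo; ⟦⟧-cong)

  mapLabels : K₁.Labelling → K₂.Labelling
  mapLabels p x y = φ (p x y)

  mapLabels-compLab : ∀ i b (p q : K₁.Labelling) u v → u < v →
    φ (C₁.compLab i p (suc b) q u v) M₂.≈ C₂.compLab i (mapLabels p) (suc b) (mapLabels q) u v
  mapLabels-compLab i b p q u v u<v = go (arcPosition i b u v u<v)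
    where
    p′ q′ : K₂.Labelling
    p′ = mapLabels p
    q′ = mapLabels q
    go : ArcPosition i b u v → φ (C₁.compLab i p (suc b) q u v) M₂.≈ C₂.compLab i p′ (suc b) q′ u v
    module L = K₁.Evaluation i b p q
    module R = K₂.Evaluation i b p′ q′
    go (glued refl refl) = K₂.≈-resp-≡ (cong φ L.compLab-glued) R.compLab-glued (homo _ _)
    go (insideQ i≤u v≤k d) =
      K₂.≈-resp-≡ (cong φ (L.compLab-insideQ i≤u v≤k d)) (R.compLab-insideQ i≤u v≤k d) M₂.refl
    go (beforeQ v≤i) = K₂.≈-resp-≡ (cong φ (L.compLab-beforeQ u<v v≤i)) (R.compLab-beforeQ u<v v≤i) M₂.refl
    go (overQ u≤i k≤v d) =
      K₂.≈-resp-≡ (cong φ (L.compLab-overQ u≤i k≤v d)) (R.compLab-overQ u≤i k≤v d) M₂.refl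
    go (afterQ k≤u) = K₂.≈-resp-≡ (cong φ (L.compLab-afterQ u<v k≤u)) (R.compLab-afterQ u<v k≤u) M₂.refl
    go (intoQ u<i i<v v<k) =
      K₂.≈-resp-≡ (cong φ (L.compLab-intoQ u<i i<v v<k)) (R.compLab-intoQ u<i i<v v<k) ε-homo
    go (outOfQ i<u u<k k<v) =
      K₂.≈-resp-≡ (cong φ (L.compLab-outOfQ i<u u<k k<v)) (R.compLab-outOfQ i<u u<k k<v) ε-homo

  C-isOperadMorphism : CIsOperadMorphism M₁ M₂ φ φ-hom
  C-isOperadMorphism = record
    { f-cong = λ p≈q x y x<y y≤n → ⟦⟧-cong (p≈q x y x<y y≤n)
    ; ∘-homo = λ {_} {b} p i q u v u<v _ → mapLabels-compLab (toℕ i) b (C₁.lab p) (C₁.lab q) u v u<v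
    ; unit-homo = λ _ _ _ _ → ε-homo
    }

  C-injective : Injective M₁._≈_ M₂._≈_ φ → ∀ a →
                Injective (C₁._≈C_ {suc a}) (C₂._≈C_ {suc a}) (C[ φ , φ-hom ] {suc a})
  C-injective φ-injective a Cφp≈Cφq x y x<y y≤n = φ-injective (Cφp≈Cφq x y x<y y≤n)

  -- In size 1 every clique is ≈C 𝐮 (its base is labelled by the unit), so no lifting is needed.
  C-surjective : Surjective M₁._≈_ M₂._≈_ φ → ∀ a →
                 Surjective (C₁._≈C_ {suc a}) (C₂._≈C_ {suc a}) (C[ φ , φ-hom ] {suc a})
  C-surjective φ-surjective zero q = C₁.𝐮 , λ {p} → Cφp≈q {p}
    where
    Cφp≈q : ∀ {p} → p C₁.≈C C₁.𝐮 → C[ φ , φ-hom ] p C₂.≈C q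
    Cφp≈q p≈𝐮 0 1 _ _ =
      M₂.trans (⟦⟧-cong (p≈𝐮 0 1 z<s ≤-refl)) (M₂.trans ε-homo (M₂.sym (C₂.base-unit q refl)))
    Cφp≈q p≈𝐮 (suc _) 1 (s≤s ()) _
    Cφp≈q p≈𝐮 _ (suc (suc _)) _ (s≤s ())
  C-surjective φ-surjective (suc a) q = C₁.mkClique preimage (λ ()) ,
    λ p≈preimage x y x<y y≤n → proj₂ (φ-surjective (C₂.lab q x y)) (p≈preimage x y x<y y≤n)
    where
    preimage : ℕ → ℕ → M₁.Carrier
    preimage x y = proj₁ (φ-surjective (C₂.lab q x y))

theorem1p1 : ∀ {c₁ ℓ₁ c₂ ℓ₂ c₃ ℓ₃} →
  -- (i) C M with the compositions ∘ᵢ and unit 𝐮 is a nonsymmetric set-operad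
  ((M : UnitalMagma c₁ ℓ₁) → CIsOperad M)
  -- (ii) C φ is a morphism of operads C M₁ → C M₂
  × ((M₁ : UnitalMagma c₁ ℓ₁) (M₂ : UnitalMagma c₂ ℓ₂)
     (φ : UnitalMagma.Carrier M₁ → UnitalMagma.Carrier M₂)
     (h : IsUnitalMagmaMorphism {M₁ = M₁} {M₂ = M₂} φ) →
     CIsOperadMorphism M₁ M₂ φ h)
  -- (iii) functoriality: C id = id
  × ((M : UnitalMagma c₁ ℓ₁) {n : ℕ} (p : Cliques.Clique M n) →
     Cliques._≈C_ M
       (C[_,_] {M₁ = M} {M₂ = M} id (MId.isMonoidHomomorphism (rawUM M) (UnitalMagma.refl M)) p) p)
  -- (iv) functoriality: C (ψ ∘ φ) = C ψ ∘ C φ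
  × ((M₁ : UnitalMagma c₁ ℓ₁) (M₂ : UnitalMagma c₂ ℓ₂) (M₃ : UnitalMagma c₃ ℓ₃)
     (φ : UnitalMagma.Carrier M₁ → UnitalMagma.Carrier M₂)
     (ψ : UnitalMagma.Carrier M₂ → UnitalMagma.Carrier M₃)
     (hφ : IsUnitalMagmaMorphism {M₁ = M₁} {M₂ = M₂} φ)
     (hψ : IsUnitalMagmaMorphism {M₁ = M₂} {M₂ = M₃} ψ)
     {n : ℕ} (p : Cliques.Clique M₁ n) →
     Cliques._≈C_ M₃
       (C[_,_] {M₁ = M₁} {M₂ = M₃} (ψ ∘ φ) (MComp.isMonoidHomomorphism (UnitalMagma.trans M₃) hφ hψ) p)
       (C[_,_] {M₁ = M₂} {M₂ = M₃} ψ hψ (C[_,_] {M₁ = M₁} {M₂ = M₂} φ hφ p)))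
  -- (v) φ injective ⇒ C φ injective (in every arity n ≥ 1)
  × ((M₁ : UnitalMagma c₁ ℓ₁) (M₂ : UnitalMagma c₂ ℓ₂)
     (φ : UnitalMagma.Carrier M₁ → UnitalMagma.Carrier M₂)
     (h : IsUnitalMagmaMorphism {M₁ = M₁} {M₂ = M₂} φ) →
     Injective (UnitalMagma._≈_ M₁) (UnitalMagma._≈_ M₂) φ →
     (a : ℕ) →
     Injective (Cliques._≈C_ M₁ {suc a}) (Cliques._≈C_ M₂ {suc a}) (C[_,_] {M₁ = M₁} {M₂ = M₂} φ h {suc a}))
  -- (vi) φ surjective ⇒ C φ surjective (in every arity n ≥ 1)
  × ((M₁ : UnitalMagma c₁ ℓ₁) (M₂ : UnitalMagma c₂ ℓ₂)
     (φ : UnitalMagma.Carrier M₁ → UnitalMagma.Carrier M₂)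
     (h : IsUnitalMagmaMorphism {M₁ = M₁} {M₂ = M₂} φ) →
     Surjective (UnitalMagma._≈_ M₁) (UnitalMagma._≈_ M₂) φ →
     (a : ℕ) →
     Surjective (Cliques._≈C_ M₁ {suc a}) (Cliques._≈C_ M₂ {suc a}) (C[_,_] {M₁ = M₁} {M₂ = M₂} φ h {suc a}))
theorem1p1 = CliqueComposition.C-isOperad
  , C-isOperadMorphism
  , (λ M _ _ _ _ _ → UnitalMagma.refl M)
  , (λ _ _ M₃ _ _ _ _ _ _ _ _ _ → UnitalMagma.refl M₃)
  , C-injective
  , C-surjective
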